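{- Let $q$ be a power of $2$, let $a\in\mathbb{F}_{q^2}^*$, $b\in\mathbb{F}_q^*$, and let $f(X)=X(1+aX^{q(q-1)}+bX^{2(q-1)})\in\mathbb{F}_{q^2}[X]$. Let $\mu_{q+1}=\{x\in\mathbb{F}_{q^2}^*: x^{q+1}=1\}$ and $$g(X)=\frac{a^qX^3+X^2+b}{bX^3+X+a}\in\mathbb{F}_{q^2}(X).$$ Fix $k\in\mathbb{F}_q$ with $\mathrm{Tr}_{q/2}(k)=1$ and let $z\in\mathbb{F}_{q^2}$ satisfy $z^2+z+k=0$. Then $f$ is a permutation polynomial of $\mathbb{F}_{q^2}$ if and only if (i) $bX^3+X+a$ has no root in $\mu_{q+1}$, and (ii) for each $y\in\mathbb{F}_q$ there is a unique $x\in\mathbb{F}_q$ such that $$g\Bigl(\frac{x+z^q}{x+z}\Bigr)=(1+a+b)^{q-1}\,\frac{y+z^q}{y+z}.$$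
   Context: $\mathbb{F}_q$ denotes the finite field with $q$ elements and $\mathrm{Tr}_{q/2}:\mathbb{F}_q\to\mathbb{F}_2$ is the absolute trace map. A permutation polynomial of $\mathbb{F}_{q^2}$ is a polynomial inducing a bijection of $\mathbb{F}_{q^2}$. Note $z\notin\mathbb{F}_q$, so $x+z\ne 0$ for $x\in\mathbb{F}_q$. -}

module Defs where

open import Data.Nat using (ℕ; zero; suc; _∸_) renaming (_*_ to _*ℕ_; _^_ to _^ℕ_; _+_ to _+ℕ_)
open import Data.List using (List; length)
open import Data.List.Membership.Propositional using (_∈_)
open import Data.List.Relation.Unary.Unique.Propositional using (Unique)
open import Relation.Binary.PropositionalEquality using (_≡_)
open import Relation.Binary.Definitions using (DecidableEquality)
open import Relation.Nullary using (¬_)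
open import Algebra.Structures using (IsCommutativeRing)

-- The inverse operation is total; its value at 0 is unconstrained and it is
-- only ever used at provably nonzero arguments in the statement.
record FiniteField : Set₁ where
  infixl 6 _+_
  infixl 7 _*_
  infix  8 -_
  field
    Carrier   : Set
    _+_ _*_   : Carrier → Carrier → Carrier
    -_        : Carrier → Carrier
    0# 1#     : Carrier
    _⁻¹       : Carrier → Carrier
    isCommutativeRing : IsCommutativeRing _≡_ _+_ _*_ -_ 0# 1#
    0≢1       : ¬ (0# ≡ 1#)
    inverseʳ  : ∀ x → ¬ (x ≡ 0#) → x * (x ⁻¹) ≡ 1#
    _≟_       : DecidableEquality Carrier
    elements  : List Carrier
    complete  : ∀ x → x ∈ elements
    unique    : Unique elements

  size : ℕ
  size = length elements

  _^_ : Carrier → ℕ → Carrier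
  x ^ zero  = 1#
  x ^ suc n = x * (x ^ n)

  _/_ : Carrier → Carrier → Carrier
  u / v = u * (v ⁻¹)

  sumTo : ℕ → (ℕ → Carrier) → Carrier
  sumTo zero    f = 0#
  sumTo (suc n) f = sumTo n f + f n

  -- absolute trace Tr_{q/2}(x) = Σ_{i<n} x^(2^i), where q = 2^n
  trace : ℕ → Carrier → Carrier
  trace n x = sumTo n (λ i → x ^ (2 ^ℕ i))

  -- membership in the subfield F_q (q = 2^n) of F_{q^2}: fixed points of x ↦ x^q
  InSub : ℕ → Carrier → Set
  InSub q x = x ^ q ≡ x

{-# OPTIONS --safe #-}
-- Write f x = x · h (x^(q-1)) with h u = 1 + a u^q + b u². Since x ↦ x^(q-1) maps 𝔽_{q²}^* onto
-- μ_{q+1} (Hilbert 90), f permutes 𝔽_{q²} iff h has no root on μ_{q+1} and u ↦ u · h(u)^(q-1)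
-- is injective there. On μ_{q+1} one has u · h u = b u³ + u + a, giving (i), and
-- u · h(u)^(q-1) = g u. As z ∉ 𝔽_q (Tr(z² + z) = 1), t ↦ (t + z^q)/(t + z) is a bijection
-- w : 𝔽_q → μ_{q+1} ∖ {1}; with g 1 = c, g permutes μ_{q+1} iff it maps μ_{q+1} ∖ {1}
-- bijectively onto μ_{q+1} ∖ {c} = c · w(𝔽_q), which is (ii).
module Submission where

open import Defs
open import Algebra.Bundles using (CommutativeRing)
open import Algebra.Structures using (IsCommutativeRing)
import Algebra.Properties.Ring as RingProperties
open import Data.Empty using (⊥-elim)
open import Data.List using (List; []; _∷_; _++_; length; map; filter; foldr)
open import Data.List.Properties using (length-++; length-map)
open import Data.List.Membership.Propositional using (_∈_)
open import Data.List.Membership.Propositional.Properties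
  using (∈-∃++; ∈-++⁻; ∈-++⁺ˡ; ∈-++⁺ʳ; ∈-map⁺; ∈-map⁻; ∈-filter⁺; ∈-filter⁻)
open import Data.List.Membership.Propositional.Properties.WithK using (unique∧set⇒bag)
open import Data.List.Relation.Binary.BagAndSetEquality using (∼bag⇒↭)
open import Data.List.Relation.Binary.Permutation.Propositional using (_↭_; ↭⇒↭ₛ)
open import Data.List.Relation.Binary.Permutation.Propositional.Properties using (↭-length)
import Data.List.Relation.Binary.Permutation.Setoid.Properties as PermutationProperties
open import Data.List.Relation.Binary.Subset.Propositional using (_⊆_)
open import Data.List.Relation.Unary.All as All using ()
open import Data.List.Relation.Unary.AllPairs using ([]; _∷_)
open import Data.List.Relation.Unary.Any using (here; there)
open import Data.List.Relation.Unary.Unique.Propositional using (Unique)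
import Data.List.Relation.Unary.Unique.Propositional.Properties as Unique
open import Data.Nat using (ℕ; zero; suc; _≤_; _≥_; _∸_; z≤n; s≤s)
  renaming (_*_ to _*ℕ_; _^_ to _^ℕ_; _+_ to _+ℕ_)
import Data.Nat.Properties as ℕ
open import Data.Product using (Σ; ∃; _×_; _,_; proj₁; proj₂)
open import Data.Sum using (_⊎_; inj₁; inj₂; [_,_]′)
open import Data.Unit using (⊤; tt)
open import Function.Base using (_∘_)
open import Function.Bundles using (_⇔_; mk⇔; module Equivalence)
open import Function.Definitions using (Injective; Surjective; Bijective)
open import Relation.Binary.Definitions using (DecidableEquality)
open import Relation.Binary.PropositionalEquality
open import Relation.Nullary using (¬_; yes; no; ¬?)
open import Relation.Unary using (Decidable)

module UniqueList {A : Set} (_≟_ : DecidableEquality A) where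

  open import Data.List.Membership.DecPropositional _≟_ using (_∈?_)

  Unique∧⊆⇒length≤ : ∀ (ys xs : List A) → Unique ys → ys ⊆ xs → length ys ≤ length xs
  Unique∧⊆⇒length≤ []       xs _            _    = z≤n
  Unique∧⊆⇒length≤ (y ∷ ys) xs (y∉ys ∷ ys!) ys⊆xs
    with as , bs , refl ← ∈-∃++ (ys⊆xs (here refl)) =
    ℕ.≤-trans (s≤s (Unique∧⊆⇒length≤ ys (as ++ bs) ys! ys⊆as++bs)) (ℕ.≤-reflexive (sym length-as++y∷bs))
    where
    ys⊆as++bs : ys ⊆ as ++ bs
    ys⊆as++bs m with ∈-++⁻ as (ys⊆xs (there m))
    ... | inj₁ p           = ∈-++⁺ˡ p
    ... | inj₂ (here refl) = ⊥-elim (All.lookup y∉ys m refl)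
    ... | inj₂ (there p)   = ∈-++⁺ʳ as p
    length-as++y∷bs : length (as ++ y ∷ bs) ≡ suc (length (as ++ bs))
    length-as++y∷bs = begin
      length (as ++ y ∷ bs)          ≡⟨ length-++ as ⟩
      length as +ℕ suc (length bs)   ≡⟨ ℕ.+-suc (length as) (length bs) ⟩
      suc (length as +ℕ length bs)   ≡⟨ cong suc (sym (length-++ as)) ⟩
      suc (length (as ++ bs))        ∎
      where open ≡-Reasoning

  map⁺-injectiveOn : (f : A → A) (xs : List A) → Unique xs →
                     (∀ {x y} → x ∈ xs → y ∈ xs → f x ≡ f y → x ≡ y) → Unique (map f xs)
  map⁺-injectiveOn f []       _            _   = []
  map⁺-injectiveOn f (x ∷ xs) (x∉xs ∷ xs!) inj =
    All.tabulate (λ m fx≡fy → let y , y∈xs , fy≡ = ∈-map⁻ f m in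
                   All.lookup x∉xs y∈xs (inj (here refl) (there y∈xs) (trans fx≡fy fy≡)))
    ∷ map⁺-injectiveOn f xs xs! (λ p r → inj (there p) (there r))

  injectiveOn⇒surjectiveOn :
    (xs : List A) → Unique xs → (f : A → A) → (∀ {x} → x ∈ xs → f x ∈ xs) →
    (∀ {x y} → x ∈ xs → y ∈ xs → f x ≡ f y → x ≡ y) →
    ∀ {y} → y ∈ xs → ∃ λ x → x ∈ xs × f x ≡ y
  injectiveOn⇒surjectiveOn xs xs! f f∈ inj {y} y∈xs with y ∈? map f xs
  ... | yes m = let x , x∈xs , y≡fx = ∈-map⁻ f m in x , x∈xs , sym y≡fx
  ... | no y∉ = ⊥-elim (ℕ.<-irrefl refl (ℕ.≤-trans (s≤s (ℕ.≤-reflexive (sym (length-map f xs)))) too-long))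
    where
    y∷image! : Unique (y ∷ map f xs)
    y∷image! = All.tabulate (λ m y≡ → y∉ (subst (_∈ map f xs) (sym y≡) m)) ∷ map⁺-injectiveOn f xs xs! inj
    y∷image⊆xs : y ∷ map f xs ⊆ xs
    y∷image⊆xs (here refl) = y∈xs
    y∷image⊆xs (there m)   = let x , x∈xs , z≡fx = ∈-map⁻ f m in subst (_∈ xs) (sym z≡fx) (f∈ x∈xs)
    too-long : length (y ∷ map f xs) ≤ length xs
    too-long = Unique∧⊆⇒length≤ (y ∷ map f xs) xs y∷image! y∷image⊆xs

module FieldProperties (K : FiniteField) where

  open FiniteField K public
  open IsCommutativeRing isCommutativeRing public
    using (+-comm; +-assoc; +-identityˡ; +-identityʳ; -‿inverseʳ;
           *-comm; *-assoc; *-identityˡ; *-identityʳ; distribˡ; distribʳ; zeroˡ; zeroʳ)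

  commutativeRing : CommutativeRing _ _
  commutativeRing = record { isCommutativeRing = isCommutativeRing }

  open import Algebra.Solver.Ring.NaturalCoefficients.Default
    (CommutativeRing.commutativeSemiring commutativeRing) public
    using (solve; _:+_; _:*_; _:=_; con)

  open ≡-Reasoning

  ^-homo-* : ∀ x m n → x ^ (m +ℕ n) ≡ x ^ m * x ^ n
  ^-homo-* x zero    n = sym (*-identityˡ _)
  ^-homo-* x (suc m) n = trans (cong (x *_) (^-homo-* x m n)) (sym (*-assoc _ _ _))

  ^-distrib-* : ∀ x y n → (x * y) ^ n ≡ x ^ n * y ^ n
  ^-distrib-* x y zero    = sym (*-identityˡ _)
  ^-distrib-* x y (suc n) = trans (cong ((x * y) *_) (^-distrib-* x y n))
    (solve 4 (λ x y u v → (x :* y) :* (u :* v) := (x :* u) :* (y :* v)) refl x y (x ^ n) (y ^ n))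

  1^n≡1 : ∀ n → 1# ^ n ≡ 1#
  1^n≡1 zero    = refl
  1^n≡1 (suc n) = trans (*-identityˡ _) (1^n≡1 n)

  ^-assocʳ : ∀ x m n → (x ^ m) ^ n ≡ x ^ (m *ℕ n)
  ^-assocʳ x zero    n = 1^n≡1 n
  ^-assocʳ x (suc m) n = begin
    (x * x ^ m) ^ n         ≡⟨ ^-distrib-* x (x ^ m) n ⟩
    x ^ n * (x ^ m) ^ n     ≡⟨ cong (x ^ n *_) (^-assocʳ x m n) ⟩
    x ^ n * x ^ (m *ℕ n)    ≡⟨ sym (^-homo-* x n (m *ℕ n)) ⟩
    x ^ (n +ℕ m *ℕ n)       ∎

  x^1≡x : ∀ x → x ^ 1 ≡ x
  x^1≡x = *-identityʳ

  x^2≡x*x : ∀ x → x ^ 2 ≡ x * x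
  x^2≡x*x x = cong (x *_) (x^1≡x x)

  x^3≡x*[x*x] : ∀ x → x ^ 3 ≡ x * (x * x)
  x^3≡x*[x*x] x = cong (x *_) (x^2≡x*x x)

  inverseˡ : ∀ x → x ≢ 0# → x ⁻¹ * x ≡ 1#
  inverseˡ x x≢0 = trans (*-comm _ _) (inverseʳ x x≢0)

  *-cancelˡ : ∀ x {y z} → x ≢ 0# → x * y ≡ x * z → y ≡ z
  *-cancelˡ x {y} {z} x≢0 xy≡xz = begin
    y                ≡⟨ sym (*-identityˡ y) ⟩
    1# * y           ≡⟨ cong (_* y) (sym (inverseˡ x x≢0)) ⟩
    (x ⁻¹ * x) * y   ≡⟨ *-assoc _ _ _ ⟩
    x ⁻¹ * (x * y)   ≡⟨ cong (x ⁻¹ *_) xy≡xz ⟩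
    x ⁻¹ * (x * z)   ≡⟨ sym (*-assoc _ _ _) ⟩
    (x ⁻¹ * x) * z   ≡⟨ cong (_* z) (inverseˡ x x≢0) ⟩
    1# * z           ≡⟨ *-identityˡ z ⟩
    z                ∎

  *-cancelʳ : ∀ x {y z} → x ≢ 0# → y * x ≡ z * x → y ≡ z
  *-cancelʳ x x≢0 yx≡zx = *-cancelˡ x x≢0 (trans (*-comm _ _) (trans yx≡zx (*-comm _ _)))

  *-nonzero : ∀ {x y} → x ≢ 0# → y ≢ 0# → x * y ≢ 0#
  *-nonzero {x} x≢0 y≢0 xy≡0 = y≢0 (*-cancelˡ x x≢0 (trans xy≡0 (sym (zeroʳ x))))

  ^-nonzero : ∀ {x} n → x ≢ 0# → x ^ n ≢ 0#
  ^-nonzero zero    _   1≡0 = 0≢1 (sym 1≡0)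
  ^-nonzero (suc n) x≢0     = *-nonzero x≢0 (^-nonzero n x≢0)

  ⁻¹-nonzero : ∀ {x} → x ≢ 0# → x ⁻¹ ≢ 0#
  ⁻¹-nonzero {x} x≢0 x⁻¹≡0 = 0≢1 (begin
    0#         ≡⟨ sym (zeroʳ x) ⟩
    x * 0#     ≡⟨ cong (x *_) (sym x⁻¹≡0) ⟩
    x * x ⁻¹   ≡⟨ inverseʳ x x≢0 ⟩
    1#         ∎)

  zero-product : ∀ {x y} → x * y ≡ 0# → x ≡ 0# ⊎ y ≡ 0#
  zero-product {x} {y} xy≡0 with x ≟ 0# | y ≟ 0#
  ... | yes x≡0 | _       = inj₁ x≡0
  ... | no _    | yes y≡0 = inj₂ y≡0
  ... | no x≢0  | no y≢0  = ⊥-elim (*-nonzero x≢0 y≢0 xy≡0)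

  /-*-cancel : ∀ {u v} → v ≢ 0# → (u / v) * v ≡ u
  /-*-cancel {u} {v} v≢0 = begin
    (u * v ⁻¹) * v   ≡⟨ *-assoc _ _ _ ⟩
    u * (v ⁻¹ * v)   ≡⟨ cong (u *_) (inverseˡ v v≢0) ⟩
    u * 1#           ≡⟨ *-identityʳ u ⟩
    u                ∎

  /-unique : ∀ {u v t} → v ≢ 0# → u ≡ t * v → u / v ≡ t
  /-unique {v = v} v≢0 u≡tv = *-cancelʳ v v≢0 (trans (/-*-cancel v≢0) u≡tv)

  /-cross : ∀ {u v u′ v′} → v ≢ 0# → v′ ≢ 0# → u / v ≡ u′ / v′ → u * v′ ≡ u′ * v
  /-cross {u} {v} {u′} {v′} v≢0 v′≢0 u/v≡u′/v′ = begin
    u * v′                 ≡⟨ cong (_* v′) (sym (/-*-cancel v≢0)) ⟩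
    (u / v) * v * v′       ≡⟨ cong (λ t → t * v * v′) u/v≡u′/v′ ⟩
    (u′ / v′) * v * v′     ≡⟨ solve 3 (λ t v v′ → t :* v :* v′ := t :* v′ :* v) refl (u′ / v′) v v′ ⟩
    (u′ / v′) * v′ * v     ≡⟨ cong (_* v) (/-*-cancel v′≢0) ⟩
    u′ * v                 ∎

  ⁻¹-unique : ∀ {y t} → y ≢ 0# → y * t ≡ 1# → t ≡ y ⁻¹
  ⁻¹-unique {y} y≢0 yt≡1 = *-cancelˡ y y≢0 (trans yt≡1 (sym (inverseʳ y y≢0)))

  ⁻¹-^ : ∀ {x} n → x ≢ 0# → (x ⁻¹) ^ n ≡ (x ^ n) ⁻¹
  ⁻¹-^ {x} n x≢0 = ⁻¹-unique (^-nonzero n x≢0) (begin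
    x ^ n * (x ⁻¹) ^ n   ≡⟨ sym (^-distrib-* x (x ⁻¹) n) ⟩
    (x * x ⁻¹) ^ n       ≡⟨ cong (_^ n) (inverseʳ x x≢0) ⟩
    1# ^ n               ≡⟨ 1^n≡1 n ⟩
    1#                   ∎)

  [r*x]^n≡x^n : ∀ {r} x n → r ^ n ≡ 1# → (r * x) ^ n ≡ x ^ n
  [r*x]^n≡x^n {r} x n r^n≡1 = trans (^-distrib-* r x n) (trans (cong (_* x ^ n) r^n≡1) (*-identityˡ _))

  x^n≡y^n⇒[x/y]^n≡1 : ∀ {x y} n → y ≢ 0# → x ^ n ≡ y ^ n → (x / y) ^ n ≡ 1#
  x^n≡y^n⇒[x/y]^n≡1 {x} {y} n y≢0 x^n≡y^n = begin
    (x * y ⁻¹) ^ n        ≡⟨ ^-distrib-* x (y ⁻¹) n ⟩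
    x ^ n * (y ⁻¹) ^ n    ≡⟨ cong₂ _*_ x^n≡y^n (⁻¹-^ n y≢0) ⟩
    y ^ n * (y ^ n) ⁻¹    ≡⟨ inverseʳ _ (^-nonzero n y≢0) ⟩
    1#                    ∎

  injectiveOn⇒surjectiveOn :
    {P : Carrier → Set} → Decidable P → (f : Carrier → Carrier) → (∀ {x} → P x → P (f x)) →
    (∀ {x y} → P x → P y → f x ≡ f y → x ≡ y) →
    ∀ {y} → P y → ∃ λ x → P x × f x ≡ y
  injectiveOn⇒surjectiveOn {P} P? f f∈P inj Py =
    let x , x∈ , fx≡y = UniqueList.injectiveOn⇒surjectiveOn _≟_ members (Unique.filter⁺ P? unique) f
                          (λ m → member (f∈P (satisfies m))) (λ m m′ → inj (satisfies m) (satisfies m′))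
                          (member Py)
    in x , satisfies x∈ , fx≡y
    where
    members : List Carrier
    members = filter P? elements
    member : ∀ {x} → P x → x ∈ members
    member = ∈-filter⁺ P? (complete _)
    satisfies : ∀ {x} → x ∈ members → P x
    satisfies m = proj₂ (∈-filter⁻ P? {xs = elements} m)

  private
    nonzeros : List Carrier
    nonzeros = filter (λ x → ¬? (x ≟ 0#)) elements

    nonzeros! : Unique nonzeros
    nonzeros! = Unique.filter⁺ (λ x → ¬? (x ≟ 0#)) unique

    ∈-nonzeros : ∀ {x} → x ≢ 0# → x ∈ nonzeros
    ∈-nonzeros = ∈-filter⁺ (λ x → ¬? (x ≟ 0#)) (complete _)

    ∈-nonzeros⁻ : ∀ {x} → x ∈ nonzeros → x ≢ 0#
    ∈-nonzeros⁻ m = proj₂ (∈-filter⁻ (λ x → ¬? (x ≟ 0#)) {xs = elements} m)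

    product : List Carrier → Carrier
    product = foldr _*_ 1#

    size≡1+|nonzeros| : size ≡ suc (length nonzeros)
    size≡1+|nonzeros| = ↭-length (∼bag⇒↭ (unique∧set⇒bag unique 0∷nonzeros! (mk⇔ to λ _ → complete _)))
      where
      0∷nonzeros! : Unique (0# ∷ nonzeros)
      0∷nonzeros! = All.tabulate (λ m 0≡x → ∈-nonzeros⁻ m (sym 0≡x)) ∷ nonzeros!
      to : elements ⊆ 0# ∷ nonzeros
      to {x} _ with x ≟ 0#
      ... | yes refl = here refl
      ... | no x≢0   = there (∈-nonzeros x≢0)

    product-nonzero : ∀ xs → (∀ {x} → x ∈ xs → x ≢ 0#) → product xs ≢ 0#
    product-nonzero []       _      1≡0 = 0≢1 (sym 1≡0)
    product-nonzero (x ∷ xs) xs≢0 = *-nonzero (xs≢0 (here refl)) (product-nonzero xs (λ m → xs≢0 (there m)))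

    product-map-* : ∀ a xs → product (map (a *_) xs) ≡ a ^ length xs * product xs
    product-map-* a []       = sym (*-identityˡ _)
    product-map-* a (x ∷ xs) = trans (cong ((a * x) *_) (product-map-* a xs))
      (solve 4 (λ a x u v → (a :* x) :* (u :* v) := (a :* u) :* (x :* v)) refl a x (a ^ length xs) (product xs))

    -- Multiplication by a ≢ 0 permutes the nonzero elements, so it leaves their product unchanged.
    fermat-nonzero : ∀ a → a ≢ 0# → a ^ length nonzeros ≡ 1#
    fermat-nonzero a a≢0 =
      *-cancelʳ (product nonzeros) (product-nonzero nonzeros ∈-nonzeros⁻) (begin
        a ^ length nonzeros * product nonzeros   ≡⟨ sym (product-map-* a nonzeros) ⟩
        product (map (a *_) nonzeros)            ≡⟨ product-↭ ⟩
        product nonzeros                         ≡⟨ sym (*-identityˡ _) ⟩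
        1# * product nonzeros                    ∎)
      where
      a*-permutes : map (a *_) nonzeros ↭ nonzeros
      a*-permutes = ∼bag⇒↭ (unique∧set⇒bag (Unique.map⁺ (*-cancelˡ a a≢0) nonzeros!) nonzeros! (mk⇔ to from))
        where
        to : map (a *_) nonzeros ⊆ nonzeros
        to m with x , x∈ , refl ← ∈-map⁻ (a *_) m = ∈-nonzeros (*-nonzero a≢0 (∈-nonzeros⁻ x∈))
        from : nonzeros ⊆ map (a *_) nonzeros
        from {y} m = subst (_∈ map (a *_) nonzeros) a*[a⁻¹*y]≡y
                       (∈-map⁺ (a *_) (∈-nonzeros (*-nonzero (⁻¹-nonzero a≢0) (∈-nonzeros⁻ m))))
          where
          a*[a⁻¹*y]≡y : a * (a ⁻¹ * y) ≡ y
          a*[a⁻¹*y]≡y = trans (sym (*-assoc _ _ _)) (trans (cong (_* y) (inverseʳ a a≢0)) (*-identityˡ y))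
      product-↭ : product (map (a *_) nonzeros) ≡ product nonzeros
      product-↭ = PermutationProperties.foldr-commMonoid (setoid Carrier)
        (IsCommutativeRing.*-isCommutativeMonoid isCommutativeRing) (↭⇒↭ₛ a*-permutes)

  fermat : ∀ x → x ^ size ≡ x
  fermat x rewrite size≡1+|nonzeros| with x ≟ 0#
  ... | yes refl = zeroˡ _
  ... | no x≢0   = trans (cong (x *_) (fermat-nonzero x x≢0)) (*-identityʳ x)

  evenSize⇒1+1≡0 : ∀ m → size ≡ 2 *ℕ m → 1# + 1# ≡ 0#
  evenSize⇒1+1≡0 m size≡2m = trans (cong (1# +_) (sym -1≡1)) (-‿inverseʳ 1#)
    where
    open RingProperties (CommutativeRing.ring commutativeRing) using (-1*x≈-x; -‿involutive)
    -1≡1 : - 1# ≡ 1#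
    -1≡1 = begin
      - 1#                  ≡⟨ sym (subst (λ e → (- 1#) ^ e ≡ - 1#) size≡2m (fermat (- 1#))) ⟩
      (- 1#) ^ (2 *ℕ m)     ≡⟨ sym (^-assocʳ (- 1#) 2 m) ⟩
      ((- 1#) ^ 2) ^ m      ≡⟨ cong (_^ m) (trans (x^2≡x*x (- 1#)) (trans (-1*x≈-x (- 1#)) (-‿involutive 1#))) ⟩
      1# ^ m                ≡⟨ 1^n≡1 m ⟩
      1#                    ∎

  module CharacteristicTwo (1+1≡0 : 1# + 1# ≡ 0#) where

    x+x≡0 : ∀ x → x + x ≡ 0#
    x+x≡0 x = begin
      x + x               ≡⟨ cong₂ _+_ (sym (*-identityʳ x)) (sym (*-identityʳ x)) ⟩
      x * 1# + x * 1#     ≡⟨ sym (distribˡ x 1# 1#) ⟩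
      x * (1# + 1#)       ≡⟨ cong (x *_) 1+1≡0 ⟩
      x * 0#              ≡⟨ zeroʳ x ⟩
      0#                  ∎

    x+y≡0⇒x≡y : ∀ {x y} → x + y ≡ 0# → x ≡ y
    x+y≡0⇒x≡y {x} {y} x+y≡0 = begin
      x               ≡⟨ sym (+-identityʳ x) ⟩
      x + 0#          ≡⟨ cong (x +_) (sym (x+x≡0 y)) ⟩
      x + (y + y)     ≡⟨ sym (+-assoc x y y) ⟩
      (x + y) + y     ≡⟨ cong (_+ y) x+y≡0 ⟩
      0# + y          ≡⟨ +-identityˡ y ⟩
      y               ∎

    +-cancelˡ : ∀ t {x y} → t + x ≡ t + y → x ≡ y
    +-cancelˡ t {x} {y} t+x≡t+y = x+y≡0⇒x≡y (begin
      x + y                  ≡⟨ sym (+-identityʳ _) ⟩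
      x + y + 0#             ≡⟨ cong (x + y +_) (sym (x+x≡0 t)) ⟩
      x + y + (t + t)        ≡⟨ solve 3 (λ t x y → x :+ y :+ (t :+ t) := (t :+ x) :+ (t :+ y)) refl t x y ⟩
      (t + x) + (t + y)      ≡⟨ cong (_+ (t + y)) t+x≡t+y ⟩
      (t + y) + (t + y)      ≡⟨ x+x≡0 (t + y) ⟩
      0#                     ∎)

    [x+y]^2≡x^2+y^2 : ∀ x y → (x + y) ^ 2 ≡ x ^ 2 + y ^ 2
    [x+y]^2≡x^2+y^2 x y = begin
      (x + y) ^ 2                          ≡⟨ x^2≡x*x _ ⟩
      (x + y) * (x + y)                    ≡⟨ solve 2 (λ x y → (x :+ y) :* (x :+ y) := (x :* x :+ y :* y) :+ (x :* y :+ x :* y)) refl x y ⟩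
      (x * x + y * y) + (x * y + x * y)    ≡⟨ cong ((x * x + y * y) +_) (x+x≡0 (x * y)) ⟩
      (x * x + y * y) + 0#                 ≡⟨ +-identityʳ _ ⟩
      x * x + y * y                        ≡⟨ sym (cong₂ _+_ (x^2≡x*x x) (x^2≡x*x y)) ⟩
      x ^ 2 + y ^ 2                        ∎

    frobenius : ∀ m x y → (x + y) ^ (2 ^ℕ m) ≡ x ^ (2 ^ℕ m) + y ^ (2 ^ℕ m)
    frobenius zero    x y = trans (x^1≡x _) (sym (cong₂ _+_ (x^1≡x x) (x^1≡x y)))
    frobenius (suc m) x y = begin
      (x + y) ^ (2 *ℕ 2 ^ℕ m)                    ≡⟨ sym (^-assocʳ (x + y) 2 (2 ^ℕ m)) ⟩
      ((x + y) ^ 2) ^ (2 ^ℕ m)                   ≡⟨ cong (_^ (2 ^ℕ m)) ([x+y]^2≡x^2+y^2 x y) ⟩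
      (x ^ 2 + y ^ 2) ^ (2 ^ℕ m)                 ≡⟨ frobenius m (x ^ 2) (y ^ 2) ⟩
      (x ^ 2) ^ (2 ^ℕ m) + (y ^ 2) ^ (2 ^ℕ m)    ≡⟨ cong₂ _+_ (^-assocʳ x 2 (2 ^ℕ m)) (^-assocʳ y 2 (2 ^ℕ m)) ⟩
      x ^ (2 *ℕ 2 ^ℕ m) + y ^ (2 *ℕ 2 ^ℕ m)      ∎

    trace[z*z+z] : ∀ m z → trace m (z * z + z) ≡ z ^ (2 ^ℕ m) + z
    trace[z*z+z] zero    z = sym (trans (cong (_+ z) (x^1≡x z)) (x+x≡0 z))
    trace[z*z+z] (suc m) z = begin
      trace m (z * z + z) + (z * z + z) ^ (2 ^ℕ m)   ≡⟨ cong₂ _+_ (trace[z*z+z] m z) (frobenius m (z * z) z) ⟩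
      (A + z) + (B + A)                              ≡⟨ solve 3 (λ A z B → (A :+ z) :+ (B :+ A) := (B :+ z) :+ (A :+ A)) refl A z B ⟩
      (B + z) + (A + A)                              ≡⟨ cong ((B + z) +_) (x+x≡0 A) ⟩
      (B + z) + 0#                                   ≡⟨ +-identityʳ _ ⟩
      B + z                                          ≡⟨ cong (λ t → t ^ (2 ^ℕ m) + z) (sym (x^2≡x*x z)) ⟩
      (z ^ 2) ^ (2 ^ℕ m) + z                         ≡⟨ cong (_+ z) (^-assocʳ z 2 (2 ^ℕ m)) ⟩
      z ^ (2 ^ℕ suc m) + z                           ∎
      where
      A = z ^ (2 ^ℕ m)
      B = (z * z) ^ (2 ^ℕ m)

module Conjugation (K : FiniteField) (n : ℕ) (n≥1 : n ≥ 1)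
                   (size≡q*q : FiniteField.size K ≡ 2 ^ℕ n *ℕ 2 ^ℕ n) where

  open FieldProperties K
  open ≡-Reasoning

  q : ℕ
  q = 2 ^ℕ n

  q-1 : ℕ
  q-1 = q ∸ 1

  private
    size-even : size ≡ 2 *ℕ (2 ^ℕ (n ∸ 1) *ℕ q)
    size-even = trans size≡q*q (2^m*2^m-even n n≥1)
      where
      2^m*2^m-even : ∀ m → m ≥ 1 → 2 ^ℕ m *ℕ 2 ^ℕ m ≡ 2 *ℕ (2 ^ℕ (m ∸ 1) *ℕ 2 ^ℕ m)
      2^m*2^m-even (suc m) _ = ℕ.*-assoc 2 (2 ^ℕ m) (2 ^ℕ suc m)

  open CharacteristicTwo (evenSize⇒1+1≡0 (2 ^ℕ (n ∸ 1) *ℕ q) size-even) public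

  x^[q*q]≡x : ∀ x → x ^ (q *ℕ q) ≡ x
  x^[q*q]≡x x = subst (λ e → x ^ e ≡ x) size≡q*q (fermat x)

  x^q≡x*x^[q-1] : ∀ x → x ^ q ≡ x * x ^ q-1
  x^q≡x*x^[q-1] x = cong (x ^_) (sym (ℕ.m+[n∸m]≡n (ℕ.m^n>0 2 n)))

  conj : Carrier → Carrier
  conj x = x ^ q

  conj-+ : ∀ x y → conj (x + y) ≡ conj x + conj y
  conj-+ = frobenius n

  conj-* : ∀ x y → conj (x * y) ≡ conj x * conj y
  conj-* x y = ^-distrib-* x y q

  conj-involutive : ∀ x → conj (conj x) ≡ x
  conj-involutive x = trans (^-assocʳ x q q) (x^[q*q]≡x x)

  conj-1 : conj 1# ≡ 1#
  conj-1 = 1^n≡1 q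

  conj-⁻¹ : ∀ {x} → x ≢ 0# → conj (x ⁻¹) ≡ conj x ⁻¹
  conj-⁻¹ {x} x≢0 = ⁻¹-unique (^-nonzero q x≢0)
    (trans (sym (conj-* x (x ⁻¹))) (trans (cong conj (inverseʳ x x≢0)) conj-1))

  conj-/ : ∀ {u v} → v ≢ 0# → conj (u / v) ≡ conj u / conj v
  conj-/ {u} {v} v≢0 = trans (conj-* u (v ⁻¹)) (cong (conj u *_) (conj-⁻¹ v≢0))

  -- μ u encodes u ∈ μ_{q+1} through the norm conj u * u = u ^ (q + 1).
  μ : Carrier → Set
  μ u = conj u * u ≡ 1#

  μ? : Decidable μ
  μ? u = (conj u * u) ≟ 1#

  u^[q+1]≡conj[u]*u : ∀ u → u ^ (q +ℕ 1) ≡ conj u * u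
  u^[q+1]≡conj[u]*u u = trans (^-homo-* u q 1) (cong (conj u *_) (x^1≡x u))

  μ⇒nonzero : ∀ {u} → μ u → u ≢ 0#
  μ⇒nonzero {u} u∈μ u≡0 = 0≢1 (begin
    0#             ≡⟨ sym (zeroʳ (conj u)) ⟩
    conj u * 0#    ≡⟨ cong (conj u *_) (sym u≡0) ⟩
    conj u * u     ≡⟨ u∈μ ⟩
    1#             ∎)

  μ-* : ∀ {u v} → μ u → μ v → μ (u * v)
  μ-* {u} {v} u∈μ v∈μ = begin
    conj (u * v) * (u * v)      ≡⟨ cong (_* (u * v)) (conj-* u v) ⟩
    (conj u * conj v) * (u * v) ≡⟨ solve 4 (λ a b c d → (a :* b) :* (c :* d) := (a :* c) :* (b :* d)) refl (conj u) (conj v) u v ⟩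
    (conj u * u) * (conj v * v) ≡⟨ cong₂ _*_ u∈μ v∈μ ⟩
    1# * 1#                     ≡⟨ *-identityˡ 1# ⟩
    1#                          ∎

  x*x^[q-1]≡conj[x] : ∀ x → x * x ^ q-1 ≡ conj x
  x*x^[q-1]≡conj[x] x = sym (x^q≡x*x^[q-1] x)

  x^[q-1]∈μ : ∀ {x} → x ≢ 0# → μ (x ^ q-1)
  x^[q-1]∈μ {x} x≢0 = *-cancelˡ (conj x * x) (*-nonzero (^-nonzero q x≢0) x≢0) (begin
    (conj x * x) * (conj u * u) ≡⟨ solve 4 (λ a b c d → (a :* b) :* (c :* d) := (a :* c) :* (b :* d)) refl (conj x) x (conj u) u ⟩
    (conj x * conj u) * (x * u) ≡⟨ cong (_* (x * u)) (sym (conj-* x u)) ⟩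
    conj (x * u) * (x * u)      ≡⟨ cong₂ _*_ (cong conj (x*x^[q-1]≡conj[x] x)) (x*x^[q-1]≡conj[x] x) ⟩
    conj (conj x) * conj x      ≡⟨ cong (_* conj x) (conj-involutive x) ⟩
    x * conj x                  ≡⟨ *-comm _ _ ⟩
    conj x * x                  ≡⟨ sym (*-identityʳ _) ⟩
    (conj x * x) * 1#           ∎)
    where u = x ^ q-1

  conj[1+x]≡1+conj[x] : ∀ x → conj (1# + x) ≡ 1# + conj x
  conj[1+x]≡1+conj[x] x = trans (conj-+ 1# x) (cong (_+ conj x) conj-1)

  u*[1+conj[u]]≡1+u : ∀ {u} → μ u → u * (1# + conj u) ≡ 1# + u
  u*[1+conj[u]]≡1+u {u} u∈μ = begin
    u * (1# + conj u)       ≡⟨ distribˡ u 1# (conj u) ⟩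
    u * 1# + u * conj u     ≡⟨ cong₂ _+_ (*-identityʳ u) (trans (*-comm u (conj u)) u∈μ) ⟩
    u + 1#                  ≡⟨ +-comm u 1# ⟩
    1# + u                  ∎

  -- Hilbert 90: for u ≠ 1 the witness is 1 + conj u.
  hilbert90 : ∀ {u} → μ u → ∃ λ x → x ≢ 0# × x ^ q-1 ≡ u
  hilbert90 {u} u∈μ with u ≟ 1#
  ... | yes refl = 1# , (λ 1≡0 → 0≢1 (sym 1≡0)) , 1^n≡1 q-1
  ... | no u≢1   = x , x≢0 , *-cancelˡ x x≢0 (trans (x*x^[q-1]≡conj[x] x) conj[x]≡x*u)
    where
    x = 1# + conj u
    x≢0 : x ≢ 0#
    x≢0 x≡0 = u≢1 (trans (sym (conj-involutive u)) (trans (cong conj (sym (x+y≡0⇒x≡y x≡0))) conj-1))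
    conj[x]≡x*u : conj x ≡ x * u
    conj[x]≡x*u = begin
      conj (1# + conj u)    ≡⟨ conj[1+x]≡1+conj[x] (conj u) ⟩
      1# + conj (conj u)    ≡⟨ cong (1# +_) (conj-involutive u) ⟩
      1# + u                ≡⟨ sym (u*[1+conj[u]]≡1+u u∈μ) ⟩
      u * x                 ≡⟨ *-comm u x ⟩
      x * u                 ∎

  trace[z*z+z]≡1⇒z∉𝔽q : ∀ {z} → trace n (z * z + z) ≡ 1# → ¬ InSub q z
  trace[z*z+z]≡1⇒z∉𝔽q {z} trace≡1 z∈𝔽q = 0≢1 (begin
    0#                    ≡⟨ sym (x+x≡0 z) ⟩
    z + z                 ≡⟨ cong (_+ z) (sym z∈𝔽q) ⟩
    z ^ q + z             ≡⟨ sym (trace[z*z+z] n z) ⟩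
    trace n (z * z + z)   ≡⟨ trace≡1 ⟩
    1#                    ∎)

  module Möbius (z : Carrier) (z∉𝔽q : ¬ InSub q z) where

    w : Carrier → Carrier
    w t = (t + conj z) / (t + z)

    t+z≢0 : ∀ {t} → InSub q t → t + z ≢ 0#
    t+z≢0 t∈𝔽q t+z≡0 = z∉𝔽q (trans (cong conj (sym t≡z)) (trans t∈𝔽q t≡z))
      where t≡z = x+y≡0⇒x≡y t+z≡0

    t+conj[z]≢0 : ∀ {t} → InSub q t → t + conj z ≢ 0#
    t+conj[z]≢0 {t} t∈𝔽q t+z̄≡0 = z∉𝔽q (begin
      conj z              ≡⟨ sym t≡z̄ ⟩
      t                   ≡⟨ sym t∈𝔽q ⟩
      conj t              ≡⟨ cong conj t≡z̄ ⟩
      conj (conj z)       ≡⟨ conj-involutive z ⟩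
      z                   ∎)
      where t≡z̄ = x+y≡0⇒x≡y t+z̄≡0

    w∈μ : ∀ {t} → InSub q t → μ (w t)
    w∈μ {t} t∈𝔽q = begin
      conj (A / B) * (A / B)              ≡⟨ cong (_* (A / B)) (conj-/ B≢0) ⟩
      (conj A / conj B) * (A / B)         ≡⟨ cong₂ (λ s r → (s / r) * (A / B)) conj[A]≡B conj[B]≡A ⟩
      (B / A) * (A / B)                   ≡⟨ solve 4 (λ A B A⁻¹ B⁻¹ → (B :* A⁻¹) :* (A :* B⁻¹) := (B :* B⁻¹) :* (A :* A⁻¹)) refl A B (A ⁻¹) (B ⁻¹) ⟩
      (B * B ⁻¹) * (A * A ⁻¹)             ≡⟨ cong₂ _*_ (inverseʳ B B≢0) (inverseʳ A (t+conj[z]≢0 t∈𝔽q)) ⟩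
      1# * 1#                             ≡⟨ *-identityˡ 1# ⟩
      1#                                  ∎
      where
      A = t + conj z
      B = t + z
      B≢0 = t+z≢0 t∈𝔽q
      conj[A]≡B : conj A ≡ B
      conj[A]≡B = trans (conj-+ t (conj z)) (cong₂ _+_ t∈𝔽q (conj-involutive z))
      conj[B]≡A : conj B ≡ A
      conj[B]≡A = trans (conj-+ t z) (cong (_+ conj z) t∈𝔽q)

    w≢1 : ∀ {t} → InSub q t → w t ≢ 1#
    w≢1 {t} t∈𝔽q wt≡1 = z∉𝔽q (+-cancelˡ t (begin
      t + conj z              ≡⟨ sym (/-*-cancel (t+z≢0 t∈𝔽q)) ⟩
      w t * (t + z)           ≡⟨ cong (_* (t + z)) wt≡1 ⟩
      1# * (t + z)            ≡⟨ *-identityˡ _ ⟩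
      t + z                   ∎))

    -- Cross-multiplying w t ≡ w t′ leaves (t + t′)(z + conj z) = 0, and z + conj z ≠ 0.
    w-injective : ∀ {t t′} → InSub q t → InSub q t′ → w t ≡ w t′ → t ≡ t′
    w-injective {t} {t′} t∈𝔽q t′∈𝔽q wt≡wt′ =
      [ x+y≡0⇒x≡y , (λ z+z̄≡0 → ⊥-elim (z∉𝔽q (sym (x+y≡0⇒x≡y z+z̄≡0)))) ]′ (zero-product [t+t′]*[z+z̄]≡0)
      where
      z̄ = conj z
      cross : (t + z̄) * (t′ + z) ≡ (t′ + z̄) * (t + z)
      cross = /-cross (t+z≢0 t∈𝔽q) (t+z≢0 t′∈𝔽q) wt≡wt′
      [t+t′]*[z+z̄]≡0 : (t + t′) * (z + z̄) ≡ 0#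
      [t+t′]*[z+z̄]≡0 = begin
        (t + t′) * (z + z̄)                                               ≡⟨ sym (+-identityʳ _) ⟩
        (t + t′) * (z + z̄) + 0#                                          ≡⟨ cong ((t + t′) * (z + z̄) +_) (sym (x+x≡0 (t * t′ + z̄ * z))) ⟩
        (t + t′) * (z + z̄) + ((t * t′ + z̄ * z) + (t * t′ + z̄ * z))     ≡⟨ solve 4 (λ t t′ z z̄ → (t :+ t′) :* (z :+ z̄) :+ ((t :* t′ :+ z̄ :* z) :+ (t :* t′ :+ z̄ :* z)) := (t :+ z̄) :* (t′ :+ z) :+ (t′ :+ z̄) :* (t :+ z)) refl t t′ z z̄ ⟩
        (t + z̄) * (t′ + z) + (t′ + z̄) * (t + z)                         ≡⟨ cong (_+ (t′ + z̄) * (t + z)) cross ⟩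
        (t′ + z̄) * (t + z) + (t′ + z̄) * (t + z)                         ≡⟨ x+x≡0 _ ⟩
        0#                                                               ∎

    -- Solving t + conj z = u (t + z) for t.
    w⁻¹ : Carrier → Carrier
    w⁻¹ u = (conj z + u * z) / (1# + u)

    module _ {u : Carrier} (u≢1 : u ≢ 1#) where

      private
        1+u≢0 : 1# + u ≢ 0#
        1+u≢0 1+u≡0 = u≢1 (sym (x+y≡0⇒x≡y 1+u≡0))

        w⁻¹[u]*[1+u] : w⁻¹ u * (1# + u) ≡ conj z + u * z
        w⁻¹[u]*[1+u] = /-*-cancel 1+u≢0

      w⁻¹∈𝔽q : μ u → InSub q (w⁻¹ u)
      w⁻¹∈𝔽q u∈μ = *-cancelʳ (1# + u) 1+u≢0 (begin
        conj t * (1# + u)              ≡⟨ cong (conj t *_) (sym (u*[1+conj[u]]≡1+u u∈μ)) ⟩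
        conj t * (u * (1# + conj u))   ≡⟨ solve 3 (λ a u b → a :* (u :* b) := u :* (a :* b)) refl (conj t) u (1# + conj u) ⟩
        u * (conj t * (1# + conj u))   ≡⟨ cong (u *_) (trans (cong (conj t *_) (sym (conj[1+x]≡1+conj[x] u))) (sym (conj-* t (1# + u)))) ⟩
        u * conj (t * (1# + u))        ≡⟨ cong (λ s → u * conj s) w⁻¹[u]*[1+u] ⟩
        u * conj (z̄ + u * z)           ≡⟨ cong (u *_) (trans (conj-+ z̄ (u * z)) (cong₂ _+_ (conj-involutive z) (conj-* u z))) ⟩
        u * (z + conj u * z̄)           ≡⟨ solve 4 (λ u z ū z̄ → u :* (z :+ ū :* z̄) := (ū :* u) :* z̄ :+ u :* z) refl u z (conj u) z̄ ⟩
        (conj u * u) * z̄ + u * z       ≡⟨ cong (λ s → s * z̄ + u * z) u∈μ ⟩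
        1# * z̄ + u * z                 ≡⟨ cong (_+ u * z) (*-identityˡ z̄) ⟩
        z̄ + u * z                      ≡⟨ sym w⁻¹[u]*[1+u] ⟩
        t * (1# + u)                   ∎)
        where
        t = w⁻¹ u
        z̄ = conj z

      w⁻¹[u]+conj[z]≡u*[w⁻¹[u]+z] : w⁻¹ u + conj z ≡ u * (w⁻¹ u + z)
      w⁻¹[u]+conj[z]≡u*[w⁻¹[u]+z] = *-cancelʳ (1# + u) 1+u≢0 (begin
        (t + z̄) * (1# + u)                          ≡⟨ distribʳ (1# + u) t z̄ ⟩
        t * (1# + u) + z̄ * (1# + u)                 ≡⟨ cong (_+ z̄ * (1# + u)) w⁻¹[u]*[1+u] ⟩
        (z̄ + u * z) + z̄ * (1# + u)                  ≡⟨ solve 3 (λ z̄ u z → (z̄ :+ u :* z) :+ z̄ :* (con 1 :+ u) := (u :* z̄ :+ u :* z) :+ (z̄ :+ z̄)) refl z̄ u z ⟩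
        (u * z̄ + u * z) + (z̄ + z̄)                   ≡⟨ cong ((u * z̄ + u * z) +_) (trans (x+x≡0 z̄) (sym (trans (cong (u *_) (x+x≡0 (u * z))) (zeroʳ u)))) ⟩
        (u * z̄ + u * z) + u * (u * z + u * z)       ≡⟨ solve 3 (λ z̄ u z → (u :* z̄ :+ u :* z) :+ u :* (u :* z :+ u :* z) := u :* ((z̄ :+ u :* z) :+ z :* (con 1 :+ u))) refl z̄ u z ⟩
        u * ((z̄ + u * z) + z * (1# + u))            ≡⟨ cong (λ s → u * (s + z * (1# + u))) (sym w⁻¹[u]*[1+u]) ⟩
        u * (t * (1# + u) + z * (1# + u))           ≡⟨ cong (u *_) (sym (distribʳ (1# + u) t z)) ⟩
        u * ((t + z) * (1# + u))                    ≡⟨ sym (*-assoc _ _ _) ⟩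
        (u * (t + z)) * (1# + u)                    ∎)
        where
        t = w⁻¹ u
        z̄ = conj z

    w-onto : ∀ {u} → μ u → u ≢ 1# → ∃ λ t → InSub q t × w t ≡ u
    w-onto {u} u∈μ u≢1 =
      w⁻¹ u , w⁻¹∈𝔽q u≢1 u∈μ , /-unique (t+z≢0 (w⁻¹∈𝔽q u≢1 u∈μ)) (w⁻¹[u]+conj[z]≡u*[w⁻¹[u]+z] u≢1)

  module Criterion (a b : Carrier) (b∈𝔽q : InSub q b) where

    f : Carrier → Carrier
    f x = x * (1# + a * (x ^ (q *ℕ (q ∸ 1))) + b * (x ^ (2 *ℕ (q ∸ 1))))

    g : Carrier → Carrier
    g x = (a ^ q * (x ^ 3) + x ^ 2 + b) / (b * (x ^ 3) + x + a)

    c : Carrier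
    c = (1# + a + b) ^ q-1

    h : Carrier → Carrier
    h u = 1# + a * conj u + b * (u ^ 2)

    D : Carrier → Carrier
    D u = b * (u ^ 3) + u + a

    NoRootOnμ : Set
    NoRootOnμ = ∀ x → x ^ (q +ℕ 1) ≡ 1# → D x ≢ 0#

    InjectiveOnμ : Set
    InjectiveOnμ = ∀ {u v} → μ u → μ v → g u ≡ g v → u ≡ v

    f≡x*h[x^[q-1]] : ∀ x → f x ≡ x * h (x ^ q-1)
    f≡x*h[x^[q-1]] x = cong (λ t → x * t) (cong₂ (λ s t → 1# + a * s + b * t)
      (trans (cong (x ^_) (ℕ.*-comm q q-1)) (sym (^-assocʳ x q-1 q)))
      (trans (cong (x ^_) (ℕ.*-comm 2 q-1)) (sym (^-assocʳ x q-1 2))))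

    f[0]≡0 : f 0# ≡ 0#
    f[0]≡0 = zeroˡ _

    u*h[u]≡D[u] : ∀ {u} → μ u → u * h u ≡ D u
    u*h[u]≡D[u] {u} u∈μ = begin
      u * (1# + a * conj u + b * (u ^ 2))             ≡⟨ cong (λ t → u * (1# + a * conj u + b * t)) (x^2≡x*x u) ⟩
      u * (1# + a * conj u + b * (u * u))             ≡⟨ solve 4 (λ u a ū b → u :* (con 1 :+ a :* ū :+ b :* (u :* u)) := b :* (u :* (u :* u)) :+ u :* con 1 :+ a :* (ū :* u)) refl u a (conj u) b ⟩
      b * (u * (u * u)) + u * 1# + a * (conj u * u)   ≡⟨ cong₂ (λ s t → b * s + u * 1# + a * t) (sym (x^3≡x*[x*x] u)) u∈μ ⟩
      b * (u ^ 3) + u * 1# + a * 1#                   ≡⟨ cong₂ (λ s t → b * (u ^ 3) + s + t) (*-identityʳ u) (*-identityʳ a) ⟩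
      D u                                             ∎

    h≡0⇒D≡0 : ∀ {u} → μ u → h u ≡ 0# → D u ≡ 0#
    h≡0⇒D≡0 {u} u∈μ hu≡0 = trans (sym (u*h[u]≡D[u] u∈μ)) (trans (cong (u *_) hu≡0) (zeroʳ u))

    D≡0⇒h≡0 : ∀ {u} → μ u → D u ≡ 0# → h u ≡ 0#
    D≡0⇒h≡0 {u} u∈μ Du≡0 with zero-product (trans (u*h[u]≡D[u] u∈μ) Du≡0)
    ... | inj₁ u≡0  = ⊥-elim (μ⇒nonzero u∈μ u≡0)
    ... | inj₂ hu≡0 = hu≡0

    conj-h : ∀ {u} → conj (h u) ≡ 1# + conj a * u + b * (conj u * conj u)
    conj-h {u} = begin
      conj (1# + a * conj u + b * (u ^ 2))                   ≡⟨ conj-+ _ _ ⟩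
      conj (1# + a * conj u) + conj (b * (u ^ 2))            ≡⟨ cong₂ _+_ (conj-+ _ _) (conj-* b (u ^ 2)) ⟩
      (conj 1# + conj (a * conj u)) + conj b * conj (u ^ 2)  ≡⟨ cong₂ (λ s t → (s + t) + conj b * conj (u ^ 2)) conj-1 (trans (conj-* a (conj u)) (cong (conj a *_) (conj-involutive u))) ⟩
      (1# + conj a * u) + conj b * conj (u ^ 2)              ≡⟨ cong₂ (λ s t → (1# + conj a * u) + s * t) b∈𝔽q (trans (cong conj (x^2≡x*x u)) (conj-* u u)) ⟩
      1# + conj a * u + b * (conj u * conj u)                ∎

    -- On μ_{q+1}, the numerator of g is u² · conj (h u) and its denominator is u · h u.
    g≡u*h^[q-1] : ∀ {u} → μ u → h u ≢ 0# → g u ≡ u * h u ^ q-1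
    g≡u*h^[q-1] {u} u∈μ hu≢0 = /-unique (λ Du≡0 → hu≢0 (D≡0⇒h≡0 u∈μ Du≡0)) (begin
      a ^ q * (u ^ 3) + u ^ 2 + b                                  ≡⟨ cong₂ (λ s t → conj a * s + t + b) (x^3≡x*[x*x] u) (x^2≡x*x u) ⟩
      conj a * (u * (u * u)) + u * u + b                           ≡⟨ cong₂ (λ s t → conj a * (u * (u * u)) + s + t) (sym (*-identityʳ (u * u))) (sym b*[ūu*ūu]≡b) ⟩
      conj a * (u * (u * u)) + u * u * 1# + b * ((ū * u) * (ū * u)) ≡⟨ solve 4 (λ ā u b ū → ā :* (u :* (u :* u)) :+ u :* u :* con 1 :+ b :* ((ū :* u) :* (ū :* u)) := (u :* u) :* (con 1 :+ ā :* u :+ b :* (ū :* ū))) refl (conj a) u b ū ⟩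
      (u * u) * (1# + conj a * u + b * (ū * ū))                    ≡⟨ cong ((u * u) *_) (sym conj-h) ⟩
      (u * u) * conj (h u)                                         ≡⟨ cong ((u * u) *_) (sym (x*x^[q-1]≡conj[x] (h u))) ⟩
      (u * u) * (h u * h u ^ q-1)                                  ≡⟨ solve 3 (λ u H P → (u :* u) :* (H :* P) := (u :* P) :* (u :* H)) refl u (h u) (h u ^ q-1) ⟩
      (u * h u ^ q-1) * (u * h u)                                  ≡⟨ cong ((u * h u ^ q-1) *_) (u*h[u]≡D[u] u∈μ) ⟩
      (u * h u ^ q-1) * D u                                        ∎)
      where
      ū = conj u
      b*[ūu*ūu]≡b : b * ((ū * u) * (ū * u)) ≡ b
      b*[ūu*ūu]≡b = trans (cong (b *_) (trans (cong₂ _*_ u∈μ u∈μ) (*-identityˡ 1#))) (*-identityʳ b)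

    f-scale : ∀ {r} x → r ^ q-1 ≡ 1# → f (r * x) ≡ r * f x
    f-scale {r} x r^[q-1]≡1 = begin
      f (r * x)                       ≡⟨ f≡x*h[x^[q-1]] (r * x) ⟩
      (r * x) * h ((r * x) ^ q-1)     ≡⟨ cong (λ t → (r * x) * h t) ([r*x]^n≡x^n x q-1 r^[q-1]≡1) ⟩
      (r * x) * h (x ^ q-1)           ≡⟨ *-assoc _ _ _ ⟩
      r * (x * h (x ^ q-1))           ≡⟨ cong (r *_) (sym (f≡x*h[x^[q-1]] x)) ⟩
      r * f x                         ∎

    D[1]≡1+a+b : D 1# ≡ 1# + a + b
    D[1]≡1+a+b = begin
      b * (1# ^ 3) + 1# + a    ≡⟨ cong (λ t → b * t + 1# + a) (1^n≡1 3) ⟩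
      b * 1# + 1# + a          ≡⟨ solve 2 (λ a b → b :* con 1 :+ con 1 :+ a := con 1 :+ a :+ b) refl a b ⟩
      1# + a + b               ∎

    module _ (noRoot : NoRootOnμ) where

      h≢0 : ∀ {u} → μ u → h u ≢ 0#
      h≢0 {u} u∈μ hu≡0 = noRoot u (trans (u^[q+1]≡conj[u]*u u) u∈μ) (h≡0⇒D≡0 u∈μ hu≡0)

      f≢0 : ∀ {x} → x ≢ 0# → f x ≢ 0#
      f≢0 {x} x≢0 fx≡0 = *-nonzero x≢0 (h≢0 (x^[q-1]∈μ x≢0)) (trans (sym (f≡x*h[x^[q-1]] x)) fx≡0)

      f^[q-1]≡g∘^[q-1] : ∀ {x} → x ≢ 0# → f x ^ q-1 ≡ g (x ^ q-1)
      f^[q-1]≡g∘^[q-1] {x} x≢0 = begin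
        f x ^ q-1                      ≡⟨ cong (_^ q-1) (f≡x*h[x^[q-1]] x) ⟩
        (x * h (x ^ q-1)) ^ q-1        ≡⟨ ^-distrib-* x _ q-1 ⟩
        x ^ q-1 * h (x ^ q-1) ^ q-1    ≡⟨ sym (g≡u*h^[q-1] (x^[q-1]∈μ x≢0) (h≢0 (x^[q-1]∈μ x≢0))) ⟩
        g (x ^ q-1)                    ∎

      g-μ : ∀ {u} → μ u → μ (g u)
      g-μ u∈μ with x , x≢0 , refl ← hilbert90 u∈μ =
        subst μ (f^[q-1]≡g∘^[q-1] x≢0) (x^[q-1]∈μ (f≢0 x≢0))

      1+a+b≢0 : 1# + a + b ≢ 0#
      1+a+b≢0 1+a+b≡0 = noRoot 1# (1^n≡1 (q +ℕ 1)) (trans D[1]≡1+a+b 1+a+b≡0)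

      c≢0 : c ≢ 0#
      c≢0 = ^-nonzero q-1 1+a+b≢0

      c∈μ : μ c
      c∈μ = x^[q-1]∈μ 1+a+b≢0

      g[1]≡c : g 1# ≡ c
      g[1]≡c = /-unique (λ D1≡0 → 1+a+b≢0 (trans (sym D[1]≡1+a+b) D1≡0)) (begin
        a ^ q * (1# ^ 3) + 1# ^ 2 + b    ≡⟨ cong₂ (λ t r → a ^ q * t + r + b) (1^n≡1 3) (1^n≡1 2) ⟩
        conj a * 1# + 1# + b             ≡⟨ solve 2 (λ ā b → ā :* con 1 :+ con 1 :+ b := (con 1 :+ ā) :+ b) refl (conj a) b ⟩
        (1# + conj a) + b                ≡⟨ cong₂ (λ t r → (t + conj a) + r) (sym conj-1) (sym b∈𝔽q) ⟩
        (conj 1# + conj a) + conj b      ≡⟨ cong (_+ conj b) (sym (conj-+ 1# a)) ⟩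
        conj (1# + a) + conj b           ≡⟨ sym (conj-+ (1# + a) b) ⟩
        conj (1# + a + b)                ≡⟨ sym (x*x^[q-1]≡conj[x] (1# + a + b)) ⟩
        (1# + a + b) * c                 ≡⟨ *-comm _ _ ⟩
        c * (1# + a + b)                 ≡⟨ cong (c *_) (sym D[1]≡1+a+b) ⟩
        c * D 1#                         ∎)

    injective⇒noRoot : Injective _≡_ _≡_ f → NoRootOnμ
    injective⇒noRoot f-inj u u^[q+1]≡1 = noRootAt (trans (sym (u^[q+1]≡conj[u]*u u)) u^[q+1]≡1)
      where
      noRootAt : ∀ {u} → μ u → D u ≢ 0#
      noRootAt u∈μ Du≡0 with x , x≢0 , refl ← hilbert90 u∈μ = x≢0 (f-inj (begin
        f x                  ≡⟨ f≡x*h[x^[q-1]] x ⟩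
        x * h (x ^ q-1)      ≡⟨ cong (x *_) (D≡0⇒h≡0 u∈μ Du≡0) ⟩
        x * 0#               ≡⟨ zeroʳ x ⟩
        0#                   ≡⟨ sym f[0]≡0 ⟩
        f 0#                 ∎))

    -- If g (x^(q-1)) = g (y^(q-1)) then f x = r · f y with r^(q-1) = 1, so f x = f (r y).
    injective⇒injectiveOnμ : Injective _≡_ _≡_ f → NoRootOnμ → InjectiveOnμ
    injective⇒injectiveOnμ f-inj noRoot u∈μ v∈μ gu≡gv
      with x , x≢0 , refl ← hilbert90 u∈μ | y , y≢0 , refl ← hilbert90 v∈μ = begin
        x ^ q-1          ≡⟨ cong (_^ q-1) (sym r*y≡x) ⟩
        (r * y) ^ q-1    ≡⟨ [r*x]^n≡x^n y q-1 r^[q-1]≡1 ⟩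
        y ^ q-1          ∎
      where
      fy≢0 = f≢0 noRoot y≢0
      r = f x / f y
      r^[q-1]≡1 : r ^ q-1 ≡ 1#
      r^[q-1]≡1 = x^n≡y^n⇒[x/y]^n≡1 q-1 fy≢0
        (trans (f^[q-1]≡g∘^[q-1] noRoot x≢0) (trans gu≡gv (sym (f^[q-1]≡g∘^[q-1] noRoot y≢0))))
      r*y≡x : r * y ≡ x
      r*y≡x = f-inj (trans (f-scale y r^[q-1]≡1) (/-*-cancel fy≢0))

    injectiveOnμ⇒bijective : NoRootOnμ → InjectiveOnμ → Bijective _≡_ _≡_ f
    injectiveOnμ⇒bijective noRoot g-inj = f-inj , f-surj
      where
      f-inj : Injective _≡_ _≡_ f
      f-inj {x} {y} fx≡fy with x ≟ 0# | y ≟ 0#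
      ... | yes x≡0  | yes y≡0 = trans x≡0 (sym y≡0)
      ... | yes refl | no y≢0  = ⊥-elim (f≢0 noRoot y≢0 (trans (sym fx≡fy) f[0]≡0))
      ... | no x≢0   | yes refl = ⊥-elim (f≢0 noRoot x≢0 (trans fx≡fy f[0]≡0))
      ... | no x≢0   | no y≢0  = *-cancelʳ (h (x ^ q-1)) (h≢0 noRoot (x^[q-1]∈μ x≢0)) (begin
          x * h (x ^ q-1)    ≡⟨ sym (f≡x*h[x^[q-1]] x) ⟩
          f x                ≡⟨ fx≡fy ⟩
          f y                ≡⟨ f≡x*h[x^[q-1]] y ⟩
          y * h (y ^ q-1)    ≡⟨ cong (λ t → y * h t) (sym x^[q-1]≡y^[q-1]) ⟩
          y * h (x ^ q-1)    ∎)
        where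
        x^[q-1]≡y^[q-1] : x ^ q-1 ≡ y ^ q-1
        x^[q-1]≡y^[q-1] = g-inj (x^[q-1]∈μ x≢0) (x^[q-1]∈μ y≢0)
          (trans (sym (f^[q-1]≡g∘^[q-1] noRoot x≢0)) (trans (cong (_^ q-1) fx≡fy) (f^[q-1]≡g∘^[q-1] noRoot y≢0)))
      f-surj : Surjective _≡_ _≡_ f
      f-surj y with x , _ , fx≡y ← injectiveOn⇒surjectiveOn {P = λ _ → ⊤} (λ _ → yes tt) f (λ _ → tt) (λ _ _ → f-inj) tt =
        x , λ { refl → fx≡y }

    bijective⇔noRoot×injectiveOnμ : Bijective _≡_ _≡_ f ⇔ (NoRootOnμ × InjectiveOnμ)
    bijective⇔noRoot×injectiveOnμ = mk⇔
      (λ (f-inj , _) → let noRoot = injective⇒noRoot f-inj in noRoot , injective⇒injectiveOnμ f-inj noRoot)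
      (λ (noRoot , g-inj) → injectiveOnμ⇒bijective noRoot g-inj)

  module UniqueSolutionsCriterion (a b : Carrier) (b∈𝔽q : InSub q b) (z : Carrier) (z∉𝔽q : ¬ InSub q z) where

    open Criterion a b b∈𝔽q public
    open Möbius z z∉𝔽q public

    UniqueSolutions : Set
    UniqueSolutions =
      ∀ y → InSub q y →
        Σ Carrier (λ x → (InSub q x × g (w x) ≡ c * w y)
          × (∀ x′ → InSub q x′ → g (w x′) ≡ c * w y → x′ ≡ x))

    module _ (noRoot : NoRootOnμ) where

      g≡c*w⇒≢1 : ∀ {u y} → InSub q y → g u ≡ c * w y → u ≢ 1#
      g≡c*w⇒≢1 {y = y} y∈𝔽q g1≡cwy refl = w≢1 y∈𝔽q (sym (*-cancelˡ c (c≢0 noRoot) (begin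
        c * 1#     ≡⟨ *-identityʳ c ⟩
        c          ≡⟨ sym (g[1]≡c noRoot) ⟩
        g 1#       ≡⟨ g1≡cwy ⟩
        c * w y    ∎)))

      -- g permutes μ_{q+1}, so c · w y has a preimage, and it is not 1 = g⁻¹(c).
      injectiveOnμ⇒uniqueSolutions : InjectiveOnμ → UniqueSolutions
      injectiveOnμ⇒uniqueSolutions g-inj y y∈𝔽q =
        let u , u∈μ , gu≡cwy = injectiveOn⇒surjectiveOn μ? g (g-μ noRoot) g-inj (μ-* (c∈μ noRoot) (w∈μ y∈𝔽q))
            t , t∈𝔽q , wt≡u  = w-onto u∈μ (g≡c*w⇒≢1 y∈𝔽q gu≡cwy)
            gwt≡cwy          = trans (cong g wt≡u) gu≡cwy
        in t , (t∈𝔽q , gwt≡cwy) ,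
           λ t′ t′∈𝔽q gwt′≡cwy → w-injective t′∈𝔽q t∈𝔽q (g-inj (w∈μ t′∈𝔽q) (w∈μ t∈𝔽q) (trans gwt′≡cwy (sym gwt≡cwy)))

      module _ (solutions : UniqueSolutions) where

        private
          solution : Carrier → Carrier
          solution y with (y ^ q) ≟ y
          ... | yes y∈𝔽q = proj₁ (solutions y y∈𝔽q)
          ... | no _     = y

          solution-spec : ∀ {y} → InSub q y → InSub q (solution y) × g (w (solution y)) ≡ c * w y
          solution-spec {y} y∈𝔽q with (y ^ q) ≟ y
          ... | yes y∈𝔽q′ = proj₁ (proj₂ (solutions y y∈𝔽q′))
          ... | no y∉𝔽q   = ⊥-elim (y∉𝔽q y∈𝔽q)

          solution-injective : ∀ {y y′} → InSub q y → InSub q y′ → solution y ≡ solution y′ → y ≡ y′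
          solution-injective y∈𝔽q y′∈𝔽q sy≡sy′ = w-injective y∈𝔽q y′∈𝔽q (*-cancelˡ c (c≢0 noRoot)
            (trans (sym (proj₂ (solution-spec y∈𝔽q)))
              (trans (cong (g ∘ w) sy≡sy′) (proj₂ (solution-spec y′∈𝔽q)))))

        -- The solution map is injective on 𝔽_q, hence onto it.
        g∘w∈c*w[𝔽q] : ∀ {t} → InSub q t → ∃ λ y → InSub q y × g (w t) ≡ c * w y
        g∘w∈c*w[𝔽q] t∈𝔽q =
          let y , y∈𝔽q , solution[y]≡t = injectiveOn⇒surjectiveOn (λ x → (x ^ q) ≟ x) solution
                                           (λ y∈𝔽q → proj₁ (solution-spec y∈𝔽q)) solution-injective t∈𝔽q
          in y , y∈𝔽q , trans (cong (g ∘ w) (sym solution[y]≡t)) (proj₂ (solution-spec y∈𝔽q))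

        g[u]≢g[1] : ∀ {u} → μ u → u ≢ 1# → g u ≢ g 1#
        g[u]≢g[1] u∈μ u≢1 gu≡g1 =
          let t , t∈𝔽q , wt≡u      = w-onto u∈μ u≢1
              y , y∈𝔽q , gwt≡cwy   = g∘w∈c*w[𝔽q] t∈𝔽q
          in g≡c*w⇒≢1 y∈𝔽q (trans (sym gu≡g1) (trans (cong g (sym wt≡u)) gwt≡cwy)) refl

        uniqueSolutions⇒injectiveOnμ : InjectiveOnμ
        uniqueSolutions⇒injectiveOnμ {u} {v} u∈μ v∈μ gu≡gv with u ≟ 1# | v ≟ 1#
        ... | yes u≡1  | yes v≡1  = trans u≡1 (sym v≡1)
        ... | yes refl | no v≢1   = ⊥-elim (g[u]≢g[1] v∈μ v≢1 (sym gu≡gv))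
        ... | no u≢1   | yes refl = ⊥-elim (g[u]≢g[1] u∈μ u≢1 gu≡gv)
        ... | no u≢1   | no v≢1   =
          let t , t∈𝔽q , wt≡u       = w-onto u∈μ u≢1
              t′ , t′∈𝔽q , wt′≡v    = w-onto v∈μ v≢1
              y , y∈𝔽q , gwt≡cwy    = g∘w∈c*w[𝔽q] t∈𝔽q
              gwt′≡cwy              = trans (cong g wt′≡v) (trans (sym gu≡gv) (trans (cong g (sym wt≡u)) gwt≡cwy))
              _ , _ , solution-unique = solutions y y∈𝔽q
          in begin
            u      ≡⟨ sym wt≡u ⟩
            w t    ≡⟨ cong w (trans (solution-unique t t∈𝔽q gwt≡cwy) (sym (solution-unique t′ t′∈𝔽q gwt′≡cwy))) ⟩
            w t′   ≡⟨ wt′≡v ⟩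
            v      ∎


proposition2p1 :
  (K : FiniteField) → let open FiniteField K in
  (n : ℕ) → n ≥ 1 →
  let q = 2 ^ℕ n in
  size ≡ q *ℕ q →
  (a b : Carrier) → ¬ (a ≡ 0#) → InSub q b → ¬ (b ≡ 0#) →
  (k : Carrier) → InSub q k → trace n k ≡ 1# →
  (z : Carrier) → z * z + z + k ≡ 0# →
  let f = λ (x : Carrier) → x * (1# + a * (x ^ (q *ℕ (q ∸ 1))) + b * (x ^ (2 *ℕ (q ∸ 1))))
      g = λ (x : Carrier) → (a ^ q * (x ^ 3) + x ^ 2 + b) / (b * (x ^ 3) + x + a)
      w = λ (t : Carrier) → (t + z ^ q) / (t + z)
      c = (1# + a + b) ^ (q ∸ 1)
  in
  Bijective _≡_ _≡_ f
  ⇔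
  ( (∀ (x : Carrier) → x ^ (q +ℕ 1) ≡ 1# → ¬ (b * (x ^ 3) + x + a ≡ 0#))
  × (∀ (y : Carrier) → InSub q y →
       Σ Carrier (λ x → (InSub q x × g (w x) ≡ c * w y)
         × (∀ (x′ : Carrier) → InSub q x′ → g (w x′) ≡ c * w y → x′ ≡ x))) )
proposition2p1 K n n≥1 size≡q*q a b _ b∈𝔽q _ k _ trace[k]≡1 z z*z+z+k≡0 = mk⇔
  (λ f-bij → let noRoot , g-inj = to f-bij in noRoot , injectiveOnμ⇒uniqueSolutions noRoot g-inj)
  (λ (noRoot , solutions) → from (noRoot , uniqueSolutions⇒injectiveOnμ noRoot solutions))
  where
  open FieldProperties K using (_+_; _*_; trace; InSub)
  open Conjugation K n n≥1 size≡q*q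
  z∉𝔽q : ¬ InSub q z
  z∉𝔽q = trace[z*z+z]≡1⇒z∉𝔽q (trans (cong (trace n) (x+y≡0⇒x≡y z*z+z+k≡0)) trace[k]≡1)
  open UniqueSolutionsCriterion a b b∈𝔽q z z∉𝔽q
  open Equivalence bijective⇔noRoot×injectiveOnμ
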